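{- Let $X$ be a finite set such that $|X|\geqslant 4$ and $|X|$ is composite. Let $\alpha\in\mathcal{S}(X)\setminus\{\mathrm{id}_X\}$ and $\beta\in\mathcal{P}(X)\setminus(\mathcal{T}(X)\cup\{\emptyset\})$. Then the distance between $\alpha$ and $\beta$ in the commuting graph $\mathcal{G}(\mathcal{P}(X))$ is at most $5$. Moreover, if $|X|=4$, then this distance is at most $4$.
   Context: $\mathcal{P}(X)$ is the partial transformation semigroup on $X$: all functions whose domain and image are subsets of $X$ (including the empty map $\emptyset$), with composition of functions as multiplication (maps act on the right, $x(\alpha\beta)=(x\alpha)\beta$). $\mathcal{T}(X)$ is the set of full transformations (maps with domain $X$) and $\mathcal{S}(X)$ the set of permutations of $X$. The center of $\mathcal{P}(X)$ is $\{\emptyset,\mathrm{id}_X\}$. For a finite non-commutative semigroup $S$, the commuting graph $\mathcal{G}(S)$ is the simple graph with vertex set $S\setminus Z(S)$ ($Z(S)$ the center), two distinct vertices $x,y$ being adjacent iff $xy=yx$. The distance between two vertices is the length of a shortest path between them ($\infty$ if none). -}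

module Defs where

open import Data.Nat using (ℕ; zero; suc; _≤_)
open import Data.Fin using (Fin)
open import Data.Maybe using (Maybe; just; nothing; _>>=_)
open import Data.Product using (Σ; ∃; _×_; _,_)
open import Relation.Binary.PropositionalEquality using (_≡_)
open import Relation.Nullary using (¬_)

-- The finite set X is taken to be Fin n (|X| = n).
-- A partial transformation of Fin n: x ↦ just y if x ∈ dom, nothing otherwise.
PT : ℕ → Set
PT n = Fin n → Maybe (Fin n)

-- Maps act on the right: x (α ∙ β) = (x α) β.
_∙_ : ∀ {n} → PT n → PT n → PT n
(α ∙ β) x = α x >>= β

_≈_ : ∀ {n} → PT n → PT n → Set
α ≈ β = ∀ x → α x ≡ β x

emptyMap : ∀ {n} → PT n
emptyMap _ = nothing

idMap : ∀ {n} → PT n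
idMap x = just x

IsFull : ∀ {n} → PT n → Set
IsFull {n} α = ∀ (x : Fin n) → ∃ λ y → α x ≡ just y

IsPerm : ∀ {n} → PT n → Set
IsPerm {n} α = IsFull α
  × (∀ (x y : Fin n) → α x ≡ α y → x ≡ y)
  × (∀ (y : Fin n) → ∃ λ x → α x ≡ just y)

-- Vertices of the commuting graph G(P(X)): elements outside the
-- center Z(P(X)) = {∅, id_X}.
IsVertex : ∀ {n} → PT n → Set
IsVertex α = ¬ (α ≈ emptyMap) × ¬ (α ≈ idMap)

Commute : ∀ {n} → PT n → PT n → Set
Commute α β = (α ∙ β) ≈ (β ∙ α)

Adj : ∀ {n} → PT n → PT n → Set
Adj α β = IsVertex α × IsVertex β × ¬ (α ≈ β) × Commute α β

data Walk {n : ℕ} : PT n → PT n → ℕ → Set where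
  nil  : ∀ {α} → Walk α α 0
  cons : ∀ {α β γ k} → Adj α β → Walk β γ k → Walk α γ (suc k)

-- dist(α, β) ≤ k in G(P(X)) (shortest walk length = shortest path length).
DistLe : ∀ {n} → PT n → PT n → ℕ → Set
DistLe α β k = ∃ λ m → m ≤ k × Walk α β m

-- Pick x outside the domain of β and y outside its image (β is not total, hence not
-- onto). The point map [ y ↦ x ] commutes with β, and with every partial identity on a
-- set containing both or neither of x and y; so every nontrivial partial identity is
-- within distance 3 of β, through the partial identity on X ∖ {x, y}.
-- If the permutation α is not an n-cycle, the partial identity on one of its orbits
-- commutes with α, so the distance is at most 4. If α is an n-cycle and n = q d with
-- 1 < d < n, then α^d commutes with α and has an orbit of at most q < n points, whose
-- partial identity gives a path of length 5. For n = 4, α² is a product of two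
-- transpositions; taking a and b in transpositions that avoid x and y respectively, the
-- map a ↦ b, α²a ↦ α²b commutes with both α² and [ y ↦ x ]: a path of length 4.
module Submission where

open import Defs
open import Data.Bool using (if_then_else_)
open import Data.Empty using (⊥-elim)
open import Data.Fin as Fin using (Fin; zero; suc; toℕ; fromℕ<; punchIn; punchOut)
open import Data.Fin.Properties
  using (all?; any?; ¬∀⟶∃¬; pigeonhole; injective⇒≤; toℕ<n; toℕ-fromℕ<;
         punchInᵢ≢i; punchIn-injective; punchIn-punchOut; punchOut-injective)
open import Data.Maybe using (Maybe; just; nothing; _>>=_)
open import Data.Maybe.Properties using (just-injective; ≡-dec)
open import Data.Nat
  using (ℕ; zero; suc; _+_; _*_; _≤_; _<_; _<?_; z≤n; s≤s; s≤s⁻¹; z<s; s<s; nonTrivial⇒n>1)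
open import Data.Nat.Properties
  using (≤-refl; ≤-trans; ≤-antisym; ≤-<-trans; <-trans; <⇒≱; n≤1+n; n<1+n; 1+n≰n;
         m<n⇒m<1+n; m≤n⇒m<n∨m≡n; m≤n+m; m≤n⇒∃[o]m+o≡n; m<m*n; +-suc)
open import Data.Nat.Divisibility.Core using (divides; hasNonTrivialDivisor)
open import Data.Nat.Primality using (Composite)
open import Data.Sum using (inj₁; inj₂)
open import Data.Product using (∃-syntax; _×_; _,_; proj₁; proj₂)
open import Function using (id; _∘_; _$_)
import Function.Endo.Propositional as Endo
open import Function.Definitions using (Injective)
open import Relation.Binary.PropositionalEquality
open ≡-Reasoning
open import Relation.Nullary using (Dec; yes; no; does; ¬_)
open import Relation.Nullary.Decidable using (_×-dec_; ¬?; True; toWitness)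
open import Relation.Unary using (Decidable)

module _ {n : ℕ} where

  ≈-sym : {φ ψ : PT n} → φ ≈ ψ → ψ ≈ φ
  ≈-sym φ≈ψ x = sym (φ≈ψ x)

  ≈-trans : {φ ψ χ : PT n} → φ ≈ ψ → ψ ≈ χ → φ ≈ χ
  ≈-trans φ≈ψ ψ≈χ x = trans (φ≈ψ x) (ψ≈χ x)

  _≈?_ : (φ ψ : PT n) → Dec (φ ≈ ψ)
  φ ≈? ψ = all? λ x → ≡-dec Fin._≟_ (φ x) (ψ x)

  ≉-at : {φ ψ : PT n} {c : Fin n} (x : Fin n) → φ x ≡ nothing → ψ x ≡ just c → ¬ (φ ≈ ψ)
  ≉-at x φx ψx φ≈ψ with () ← trans (sym φx) (trans (φ≈ψ x) ψx)

  ∙-congˡ : {φ φ′ ψ : PT n} → φ ≈ φ′ → (φ ∙ ψ) ≈ (φ′ ∙ ψ)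
  ∙-congˡ φ≈φ′ x = cong (_>>= _) (φ≈φ′ x)

  ∙-congʳ : {φ ψ ψ′ : PT n} → ψ ≈ ψ′ → (φ ∙ ψ) ≈ (φ ∙ ψ′)
  ∙-congʳ {φ} ψ≈ψ′ x with φ x
  ... | just y  = ψ≈ψ′ y
  ... | nothing = refl

  isVertex-resp : {φ φ′ : PT n} → φ ≈ φ′ → IsVertex φ′ → IsVertex φ
  isVertex-resp φ≈φ′ (φ′≉∅ , φ′≉id) =
    (φ′≉∅ ∘ ≈-trans (≈-sym φ≈φ′)) , (φ′≉id ∘ ≈-trans (≈-sym φ≈φ′))

  adj-sym : {φ ψ : PT n} → Adj φ ψ → Adj ψ φ
  adj-sym (vφ , vψ , φ≉ψ , φψ) = vψ , vφ , φ≉ψ ∘ ≈-sym , ≈-sym φψ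

  adj-respˡ : {φ φ′ ψ : PT n} → φ ≈ φ′ → Adj φ′ ψ → Adj φ ψ
  adj-respˡ {ψ = ψ} φ≈φ′ (vφ′ , vψ , φ′≉ψ , φ′ψ) =
    isVertex-resp φ≈φ′ vφ′ , vψ , φ′≉ψ ∘ ≈-trans (≈-sym φ≈φ′) ,
    ≈-trans (∙-congˡ φ≈φ′) (≈-trans φ′ψ (∙-congʳ {φ = ψ} (≈-sym φ≈φ′)))

  adj-respʳ : {φ ψ ψ′ : PT n} → ψ ≈ ψ′ → Adj φ ψ′ → Adj φ ψ
  adj-respʳ ψ≈ψ′ = adj-sym ∘ adj-respˡ ψ≈ψ′ ∘ adj-sym

  adj-dist : {φ ψ χ : PT n} {k : ℕ} → Adj φ ψ → DistLe ψ χ k → DistLe φ χ (suc k)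
  adj-dist φψ (m , m≤k , walk) = suc m , s≤s m≤k , cons φψ walk

  dist-mono : {φ χ : PT n} {k k′ : ℕ} → k ≤ k′ → DistLe φ χ k → DistLe φ χ k′
  dist-mono k≤k′ (m , m≤k , walk) = m , ≤-trans m≤k k≤k′ , walk

  adj-commute⇒dist≤2 : {φ ψ χ : PT n} → Adj φ ψ → IsVertex χ → Commute ψ χ → DistLe φ χ 2
  adj-commute⇒dist≤2 {ψ = ψ} {χ} φψ vχ ψχ with ψ ≈? χ
  ... | yes ψ≈χ = 1 , s≤s z≤n , cons (adj-respʳ (≈-sym ψ≈χ) φψ) nil
  ... | no ψ≉χ  = 2 , ≤-refl , cons φψ (cons (proj₁ (proj₂ φψ) , vχ , ψ≉χ , ψχ) nil)

total : {n : ℕ} → (Fin n → Fin n) → PT n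
total f x = just (f x)

idOn : {n : ℕ} {P : Fin n → Set} → Decidable P → PT n
idOn P? x = if does (P? x) then just x else nothing

[_↦_] : {n : ℕ} → Fin n → Fin n → PT n
[ y ↦ x ] z = if does (z Fin.≟ y) then just x else nothing

module _ {n : ℕ} where

  total-commute : {f g : Fin n → Fin n} → (∀ x → g (f x) ≡ f (g x)) → Commute (total f) (total g)
  total-commute gf x = cong just (gf x)

  partial-isVertex : {φ : PT n} {c : Fin n} (a b : Fin n) → φ a ≡ just c → φ b ≡ nothing → IsVertex φ
  partial-isVertex a b φa φb = ≉-at a refl φa ∘ ≈-sym , ≉-at b φb refl

  total-isVertex : {f : Fin n → Fin n} (a : Fin n) → f a ≢ a → IsVertex (total f)
  total-isVertex a fa≢a = ≉-at a refl refl ∘ ≈-sym , fa≢a ∘ just-injective ∘ (_$ a)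

  total-≉ : {f g : Fin n → Fin n} (a : Fin n) → f a ≢ g a → ¬ (total f ≈ total g)
  total-≉ a fa≢ga = fa≢ga ∘ just-injective ∘ (_$ a)

module _ {n : ℕ} {P : Fin n → Set} (P? : Decidable P) where

  idOn-∈ : {x : Fin n} → P x → idOn P? x ≡ just x
  idOn-∈ {x} Px with P? x
  ... | yes _  = refl
  ... | no ¬Px = ⊥-elim (¬Px Px)

  idOn-∉ : {x : Fin n} → ¬ P x → idOn P? x ≡ nothing
  idOn-∉ {x} ¬Px with P? x
  ... | yes Px = ⊥-elim (¬Px Px)
  ... | no _   = refl

  idOn-isVertex : {a b : Fin n} → P a → ¬ P b → IsVertex (idOn P?)
  idOn-isVertex {a} {b} Pa ¬Pb = partial-isVertex a b (idOn-∈ Pa) (idOn-∉ ¬Pb)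

  idOn-commute-total : {f : Fin n → Fin n} → (∀ {x} → P x → P (f x)) → (∀ {x} → P (f x) → P x) →
                       Commute (idOn P?) (total f)
  idOn-commute-total P-fwd P-bwd x with P? x
  ... | yes Px = sym (idOn-∈ (P-fwd Px))
  ... | no ¬Px = sym (idOn-∉ (¬Px ∘ P-bwd))

  total-adj-idOn : {f : Fin n → Fin n} {b c : Fin n} (a : Fin n) → f a ≢ a →
                   (∀ {x} → P x → P (f x)) → (∀ {x} → P (f x) → P x) → P b → ¬ P c →
                   Adj (total f) (idOn P?)
  total-adj-idOn {c = c} a fa≢a P-fwd P-bwd Pb ¬Pc =
    total-isVertex a fa≢a , idOn-isVertex Pb ¬Pc , ≉-at c (idOn-∉ ¬Pc) refl ∘ ≈-sym ,
    ≈-sym (idOn-commute-total P-fwd P-bwd)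

module _ {n : ℕ} {P Q : Fin n → Set} (P? : Decidable P) (Q? : Decidable Q) where

  idOn-commute-idOn : Commute (idOn P?) (idOn Q?)
  idOn-commute-idOn x with P? x | Q? x
  ... | yes Px | yes Qx = trans (idOn-∈ Q? Qx) (sym (idOn-∈ P? Px))
  ... | yes _  | no ¬Qx = idOn-∉ Q? ¬Qx
  ... | no ¬Px | yes _  = sym (idOn-∉ P? ¬Px)
  ... | no _   | no _   = refl

↦-at : {n : ℕ} (y x : Fin n) → [ y ↦ x ] y ≡ just x
↦-at y _ with y Fin.≟ y
... | yes _   = refl
... | no y≢y  = ⊥-elim (y≢y refl)

module _ {n : ℕ} {y x : Fin n} where

  ↦-off : {z : Fin n} → z ≢ y → [ y ↦ x ] z ≡ nothing
  ↦-off {z} z≢y with z Fin.≟ y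
  ... | yes z≡y = ⊥-elim (z≢y z≡y)
  ... | no _    = refl

  ↦-isVertex : {w : Fin n} → w ≢ y → IsVertex [ y ↦ x ]
  ↦-isVertex {w} w≢y = partial-isVertex y w (↦-at y x) (↦-off w≢y)

  ↦-commute : {β : PT n} → β x ≡ nothing → (∀ z → β z ≢ just y) → Commute [ y ↦ x ] β
  ↦-commute {β} βx y∉imβ z = trans (left z (z Fin.≟ y)) (sym (right z))
    where
      left : ∀ z → Dec (z ≡ y) → ([ y ↦ x ] ∙ β) z ≡ nothing
      left z (yes refl) = trans (cong (_>>= β) (↦-at y x)) βx
      left z (no z≢y)   = cong (_>>= β) (↦-off z≢y)
      right : ∀ z → (β ∙ [ y ↦ x ]) z ≡ nothing
      right z with β z in βz
      ... | nothing = refl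
      ... | just w with w Fin.≟ y
      ...   | yes refl = ⊥-elim (y∉imβ z βz)
      ...   | no _     = refl

  idOn-commute-↦ : {P : Fin n → Set} (P? : Decidable P) → (P y → P x) → (P x → P y) →
                   Commute (idOn P?) [ y ↦ x ]
  idOn-commute-↦ P? Py→Px Px→Py z with z Fin.≟ y | P? z
  ... | yes refl | yes Py = trans (↦-at z x) (sym (idOn-∈ P? (Py→Px Py)))
  ... | yes refl | no ¬Py = sym (idOn-∉ P? (¬Py ∘ Px→Py))
  ... | no z≢y   | yes _  = ↦-off z≢y
  ... | no _     | no _   = refl

module _ {n : ℕ} (β : PT n) where

  undefined-point : ¬ IsFull β → ∃[ x ] β x ≡ nothing
  undefined-point β-partial with any? (λ x → ≡-dec Fin._≟_ (β x) nothing)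
  ... | yes found = found
  ... | no none   = ⊥-elim (β-partial λ x → defined (β x) (none ∘ (x ,_)))
    where
      defined : (m : Maybe (Fin n)) → m ≢ nothing → ∃[ y ] m ≡ just y
      defined (just y) _  = y , refl
      defined nothing  m≢ = ⊥-elim (m≢ refl)

module _ {n : ℕ} (β : PT (suc n)) where

  hasPreimage? : Decidable (λ y → ∃[ z ] β z ≡ just y)
  hasPreimage? y = any? λ z → ≡-dec Fin._≟_ (β z) (just y)

  -- If every point had a preimage, punching x out of chosen preimages would inject Fin (suc n) into Fin n.
  missing-image : {x : Fin (suc n)} → β x ≡ nothing → ∃[ y ] ∀ z → β z ≢ just y
  missing-image {x} βx with all? hasPreimage?
  ... | no ¬onto with y , ¬pre ← ¬∀⟶∃¬ (suc n) _ hasPreimage? ¬onto = y , λ z βz → ¬pre (z , βz)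
  ... | yes onto = ⊥-elim (1+n≰n (injective⇒≤ punchOut∘pre-injective))
    where
      pre : Fin (suc n) → Fin (suc n)
      pre y = proj₁ (onto y)
      x≢pre : ∀ y → x ≢ pre y
      x≢pre y x≡pre with () ← trans (sym βx) (trans (cong β x≡pre) (proj₂ (onto y)))
      punchOut∘pre-injective : Injective _≡_ _≡_ (λ y → punchOut (x≢pre y))
      punchOut∘pre-injective {y} {y′} eq =
        just-injective (trans (sym (proj₂ (onto y))) (trans (cong β (punchOut-injective (x≢pre y) (x≢pre y′) eq)) (proj₂ (onto y′))))

avoid-two : {n : ℕ} (y x : Fin (3 + n)) → ∃[ z ] z ≢ y × z ≢ x
avoid-two y x with y Fin.≟ x
... | yes refl = punchIn y zero , punchInᵢ≢i y zero , punchInᵢ≢i y zero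
... | no y≢x   = punchIn y (punchIn j zero) , punchInᵢ≢i y _ , z≢x
  where
    j = punchOut y≢x
    z≢x : punchIn y (punchIn j zero) ≢ x
    z≢x z≡x = punchInᵢ≢i j zero (punchIn-injective y _ _ (trans z≡x (sym (punchIn-punchOut y≢x))))

module PartialIdentityDistance {n : ℕ} {β : PT (3 + n)} (β-isVertex : IsVertex β)
                               {x y : Fin (3 + n)} (βx : β x ≡ nothing) (y∉imβ : ∀ z → β z ≢ just y) where

  ↦-commute-β : Commute [ y ↦ x ] β
  ↦-commute-β = ↦-commute βx y∉imβ

  Off : Fin (3 + n) → Set
  Off z = z ≢ y × z ≢ x

  Off? : Decidable Off
  Off? z = ¬? (z Fin.≟ y) ×-dec ¬? (z Fin.≟ x)

  ¬Off-y : ¬ Off y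
  ¬Off-y (y≢y , _) = y≢y refl

  Off-third : Off (proj₁ (avoid-two y x))
  Off-third = proj₂ (avoid-two y x)

  idOff-adj-↦ : Adj (idOn Off?) [ y ↦ x ]
  idOff-adj-↦ = idOn-isVertex Off? Off-third ¬Off-y , ↦-isVertex (proj₁ Off-third) ,
                ≉-at y (idOn-∉ Off? ¬Off-y) (↦-at y x) ,
                idOn-commute-↦ Off? (⊥-elim ∘ ¬Off-y) (λ Off-x → ⊥-elim (proj₂ Off-x refl))

  idOn-dist≤3 : {P : Fin (3 + n) → Set} (P? : Decidable P) {a b : Fin (3 + n)} →
                P a → ¬ P b → DistLe (idOn P?) β 3
  idOn-dist≤3 P? Pa ¬Pb with idOn P? ≈? idOn Off?
  ... | yes P≈Off = dist-mono (n≤1+n 2) (adj-commute⇒dist≤2 (adj-respˡ P≈Off idOff-adj-↦) β-isVertex ↦-commute-β)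
  ... | no P≉Off  = adj-dist (idOn-isVertex P? Pa ¬Pb , proj₁ idOff-adj-↦ , P≉Off , idOn-commute-idOn P? Off?)
                             (adj-commute⇒dist≤2 idOff-adj-↦ β-isVertex ↦-commute-β)

<⇒+suc : {i j : ℕ} → i < j → ∃[ c ] i + suc c ≡ j
<⇒+suc {i} i<j with c , i+1+c≡j ← m≤n⇒∃[o]m+o≡n i<j = c , trans (+-suc i c) i+1+c≡j

module Iteration {n : ℕ} (g : Fin n → Fin n) (g-injective : Injective _≡_ _≡_ g) where

  open Endo (Fin n) public using (_^_)
  open Endo (Fin n) using (^-homo)

  ^-injective : ∀ k → Injective _≡_ _≡_ (g ^ k)
  ^-injective zero    = id
  ^-injective (suc k) = ^-injective k ∘ g-injective

  ^-comm : ∀ k x → (g ^ k) (g x) ≡ g ((g ^ k) x)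
  ^-comm zero    x = refl
  ^-comm (suc k) x = cong g (^-comm k x)

  ^-+ : ∀ i j x → (g ^ (i + j)) x ≡ (g ^ i) ((g ^ j) x)
  ^-+ i j = cong-app (^-homo g i j)

  ^-* : ∀ q d x → ((g ^ d) ^ q) x ≡ (g ^ (q * d)) x
  ^-* zero    d x = refl
  ^-* (suc q) d x = trans (cong (g ^ d) (^-* q d x)) (sym (^-+ d (q * d) x))

  ^-cancel : ∀ i m {x} → (g ^ i) x ≡ (g ^ (i + m)) x → (g ^ m) x ≡ x
  ^-cancel i m {x} eq = sym (^-injective i (trans eq (^-+ i m x)))

  period : (o : Fin n) → ∃[ e ] suc e ≤ n × (g ^ suc e) o ≡ o
  period o with pigeonhole (n<1+n n) (λ (i : Fin (suc n)) → (g ^ toℕ i) o)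
  ... | i , j , i<j , eq with <⇒+suc i<j
  ...   | c , i+1+c≡j =
    c , ≤-trans (subst (suc c ≤_) i+1+c≡j (m≤n+m (suc c) (toℕ i))) (s≤s⁻¹ (toℕ<n j)) ,
    ^-cancel (toℕ i) (suc c) (trans eq (cong (λ k → (g ^ k) o) (sym i+1+c≡j)))

  module Orbit (o : Fin n) (e : ℕ) (e+1-period : (g ^ suc e) o ≡ o) where

    InOrbit : Fin n → Set
    InOrbit z = ∃[ k ] (g ^ toℕ {suc e} k) o ≡ z

    InOrbit? : Decidable InOrbit
    InOrbit? z = any? λ k → (g ^ toℕ k) o Fin.≟ z

    orbit-at : ∀ {k z} → k < suc e → (g ^ k) o ≡ z → InOrbit z
    orbit-at k<e+1 eq = fromℕ< k<e+1 , trans (cong (λ i → (g ^ i) o) (toℕ-fromℕ< k<e+1)) eq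

    orbit-suc : ∀ {z} → InOrbit z → InOrbit (g z)
    orbit-suc {z} (k , eq) with m≤n⇒m<n∨m≡n (toℕ<n k)
    ... | inj₁ k+1<e+1 = orbit-at k+1<e+1 (cong g eq)
    ... | inj₂ k+1≡e+1 = orbit-at (s≤s z≤n) (begin
      o                    ≡⟨ e+1-period ⟨
      (g ^ suc e) o        ≡⟨ cong (λ i → (g ^ i) o) k+1≡e+1 ⟨
      g ((g ^ toℕ k) o)    ≡⟨ cong g eq ⟩
      g z                  ∎)

    orbit-pred : ∀ {z} → InOrbit (g z) → InOrbit z
    orbit-pred (zero  , eq) = orbit-at (n<1+n e) (g-injective (trans e+1-period eq))
    orbit-pred (suc k , eq) = orbit-at (m<n⇒m<1+n (toℕ<n k)) (g-injective eq)

    orbit-iterate : ∀ k → InOrbit ((g ^ k) o)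
    orbit-iterate zero    = zero , refl
    orbit-iterate (suc k) = orbit-suc (orbit-iterate k)

    full-orbit⇒≤ : (∀ z → InOrbit z) → n ≤ suc e
    full-orbit⇒≤ full = injective⇒≤ {f = proj₁ ∘ full} λ {z} {z′} eq →
      trans (sym (proj₂ (full z))) (trans (cong (λ k → (g ^ toℕ k) o) eq) (proj₂ (full z′)))

  Transitive : Fin n → Set
  Transitive o = ∀ z → ∃[ k ] (g ^ k) o ≡ z

  module _ {o : Fin n} (transitive : Transitive o) where

    period-≥ : ∀ e → (g ^ suc e) o ≡ o → n ≤ suc e
    period-≥ e e+1-period = full-orbit⇒≤ λ z → subst InOrbit (proj₂ (transitive z)) (orbit-iterate (proj₁ (transitive z)))
      where open Orbit o e e+1-period

    ^n-fixes : (g ^ n) o ≡ o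
    ^n-fixes with e , e+1≤n , e+1-period ← period o =
      subst (λ k → (g ^ k) o ≡ o) (≤-antisym e+1≤n (period-≥ e e+1-period)) e+1-period

    iterates-distinct : ∀ {i j} → i < j → j < n → (g ^ i) o ≢ (g ^ j) o
    iterates-distinct {i} {j} i<j j<n eq with c , i+c+1≡j ← <⇒+suc i<j =
      <⇒≱ (≤-<-trans (subst (suc c ≤_) i+c+1≡j (m≤n+m (suc c) i)) j<n)
          (period-≥ c (^-cancel i (suc c) (trans eq (cong (λ k → (g ^ k) o) (sym i+c+1≡j)))))

module PairMap {n : ℕ} (g : Fin n → Fin n) (g-injective : Injective _≡_ _≡_ g) {a b : Fin n}
               (g²a≡a : g (g a) ≡ a) (g²b≡b : g (g b) ≡ b) (ga≢a : g a ≢ a) where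

  γ : PT n
  γ z = if does (z Fin.≟ a) then just b else [ g a ↦ g b ] z

  γ-a : γ a ≡ just b
  γ-a with a Fin.≟ a
  ... | yes _   = refl
  ... | no a≢a  = ⊥-elim (a≢a refl)

  γ-ga : γ (g a) ≡ just (g b)
  γ-ga with g a Fin.≟ a
  ... | yes ga≡a = ⊥-elim (ga≢a ga≡a)
  ... | no _     = ↦-at (g a) (g b)

  γ-off : ∀ {z} → z ≢ a → z ≢ g a → γ z ≡ nothing
  γ-off {z} z≢a z≢ga with z Fin.≟ a
  ... | yes z≡a = ⊥-elim (z≢a z≡a)
  ... | no _    = ↦-off z≢ga

  γ-commute-total : Commute γ (total g)
  γ-commute-total z = on z (z Fin.≟ a) (z Fin.≟ g a)
    where
      on : ∀ z → Dec (z ≡ a) → Dec (z ≡ g a) → (γ ∙ total g) z ≡ (total g ∙ γ) z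
      on z (yes refl) _          = trans (cong (_>>= total g) γ-a) (sym γ-ga)
      on z (no _)     (yes refl) = begin
        (γ (g a) >>= total g) ≡⟨ cong (_>>= total g) γ-ga ⟩
        just (g (g b))        ≡⟨ cong just g²b≡b ⟩
        just b                ≡⟨ γ-a ⟨
        γ a                   ≡⟨ cong γ g²a≡a ⟨
        γ (g (g a))           ∎
      on z (no z≢a)   (no z≢ga)  = trans (cong (_>>= total g) (γ-off z≢a z≢ga)) (sym (γ-off gz≢a gz≢ga))
        where
          gz≢a : g z ≢ a
          gz≢a gz≡a = z≢ga (g-injective (trans gz≡a (sym g²a≡a)))
          gz≢ga : g z ≢ g a
          gz≢ga = z≢a ∘ g-injective

  module Avoiding {y x : Fin n} (x≢a : x ≢ a) (x≢ga : x ≢ g a) (y≢b : y ≢ b) (y≢gb : y ≢ g b) where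

    γ-isVertex : IsVertex γ
    γ-isVertex = partial-isVertex a x γ-a (γ-off x≢a x≢ga)

    total-≉-γ : ¬ (total g ≈ γ)
    total-≉-γ = ≉-at x (γ-off x≢a x≢ga) refl ∘ ≈-sym

    γ-commute-↦ : Commute γ [ y ↦ x ]
    γ-commute-↦ z = trans (γ-then-↦ z (z Fin.≟ a) (z Fin.≟ g a)) (sym (↦-then-γ z (z Fin.≟ y)))
      where
        γ-then-↦ : ∀ z → Dec (z ≡ a) → Dec (z ≡ g a) → (γ ∙ [ y ↦ x ]) z ≡ nothing
        γ-then-↦ z (yes refl) _        = trans (cong (_>>= [ y ↦ x ]) γ-a) (↦-off (y≢b ∘ sym))
        γ-then-↦ z (no _)     (yes refl) = trans (cong (_>>= [ y ↦ x ]) γ-ga) (↦-off (y≢gb ∘ sym))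
        γ-then-↦ z (no z≢a)   (no z≢ga)  = cong (_>>= [ y ↦ x ]) (γ-off z≢a z≢ga)
        ↦-then-γ : ∀ z → Dec (z ≡ y) → ([ y ↦ x ] ∙ γ) z ≡ nothing
        ↦-then-γ z (yes refl) = trans (cong (_>>= γ) (↦-at y x)) (γ-off x≢a x≢ga)
        ↦-then-γ z (no z≢y)   = cong (_>>= γ) (↦-off z≢y)

    γ-≉-↦ : ¬ (γ ≈ [ y ↦ x ])
    γ-≉-↦ with a Fin.≟ y
    ... | no a≢y  = ≉-at a (↦-off a≢y) γ-a ∘ ≈-sym
    ... | yes refl = ≉-at (g a) (↦-off ga≢a) γ-ga ∘ ≈-sym

module Distances {n : ℕ} {β : PT (3 + n)} (β-isVertex : IsVertex β)
                 {x y : Fin (3 + n)} (βx : β x ≡ nothing) (y∉imβ : ∀ z → β z ≢ just y)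
                 {α : PT (3 + n)} {f : Fin (3 + n) → Fin (3 + n)} (α≈f : α ≈ total f)
                 (f-injective : Injective _≡_ _≡_ f) (α≉id : ¬ (α ≈ idMap)) where

  open PartialIdentityDistance β-isVertex βx y∉imβ
  open Iteration f f-injective

  f-moves : ∃[ a ] f a ≢ a
  f-moves = ¬∀⟶∃¬ (3 + n) _ (λ a → f a Fin.≟ a) λ fixes → α≉id λ a → trans (α≈f a) (cong just (fixes a))

  o : Fin (3 + n)
  o = zero

  open Orbit o (proj₁ (period o)) (proj₂ (proj₂ (period o)))

  nontransitive⇒dist≤4 : ∀ {z} → ¬ InOrbit z → DistLe α β 4
  nontransitive⇒dist≤4 z∉ =
    adj-dist (adj-respˡ α≈f (total-adj-idOn InOrbit? (proj₁ f-moves) (proj₂ f-moves) orbit-suc orbit-pred (orbit-iterate 0) z∉))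
             (idOn-dist≤3 InOrbit? (orbit-iterate 0) z∉)

  module _ (transitive : Transitive o) where

    f-adj-^ : ∀ {d} → 1 < d → d < 3 + n → Adj (total f) (total (f ^ d))
    f-adj-^ {d} 1<d d<N =
      total-isVertex (proj₁ f-moves) (proj₂ f-moves) ,
      total-isVertex o (iterates-distinct transitive (<-trans z<s 1<d) d<N ∘ sym) ,
      total-≉ o (iterates-distinct transitive 1<d d<N) ,
      total-commute {f = f} {g = f ^ d} (^-comm d)

    composite⇒dist≤5 : Composite (3 + n) → DistLe α β 5
    composite⇒dist≤5 (hasNonTrivialDivisor {d} d<N (divides (suc q) N≡q*d)) =
      adj-dist (adj-respˡ α≈f (f-adj-^ 1<d d<N))
        (adj-dist (total-adj-idOn σ.InOrbit? o σo≢o σ.orbit-suc σ.orbit-pred (σ.orbit-iterate 0) z∉)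
                  (idOn-dist≤3 σ.InOrbit? (σ.orbit-iterate 0) z∉))
      where
        1<d : 1 < d
        1<d = nonTrivial⇒n>1 d
        σo≢o : (f ^ d) o ≢ o
        σo≢o = iterates-distinct transitive (<-trans z<s 1<d) d<N ∘ sym
        σ-period : ((f ^ d) ^ suc q) o ≡ o
        σ-period = trans (^-* (suc q) d o) (subst (λ k → (f ^ k) o ≡ o) N≡q*d (^n-fixes transitive))
        module σ = Iteration.Orbit (f ^ d) (^-injective d) o q σ-period
        -- The orbit of o under f ^ d has at most q < n points.
        σ-orbit-proper : ¬ (∀ z → σ.InOrbit z)
        σ-orbit-proper full = <⇒≱ (subst (suc q <_) (sym N≡q*d) (m<m*n (suc q) d 1<d)) (σ.full-orbit⇒≤ full)
        z∉ = proj₂ (¬∀⟶∃¬ (3 + n) _ σ.InOrbit? σ-orbit-proper)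

    module _ (N≡4 : 3 + n ≡ 4) where

      p : ℕ → Fin (3 + n)
      p k = (f ^ k) o

      distinct : ∀ i j {_ : True (i <? j)} {_ : True (j <? 4)} → p i ≢ p j
      distinct i j {i<j} {j<4} = iterates-distinct transitive (toWitness i<j) (subst (j <_) (sym N≡4) (toWitness j<4))

      p4≡p0 : p 4 ≡ p 0
      p4≡p0 = subst (λ k → p k ≡ o) N≡4 (^n-fixes transitive)

      -- σ = f² is the double transposition (p0 p2)(p1 p3); one of its two cycles avoids t.
      AvoidingPair : Fin (3 + n) → Fin (3 + n) → Set
      AvoidingPair t a = (f ^ 2) ((f ^ 2) a) ≡ a × (f ^ 2) a ≢ a × t ≢ a × t ≢ (f ^ 2) a

      avoiding-pair : ∀ t → ∃[ a ] AvoidingPair t a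
      avoiding-pair t with t Fin.≟ p 0 | t Fin.≟ p 2
      ... | yes refl | _        = p 1 , cong f p4≡p0 , distinct 1 3 ∘ sym , distinct 0 1 , distinct 0 3
      ... | no _     | yes refl = p 1 , cong f p4≡p0 , distinct 1 3 ∘ sym , distinct 1 2 ∘ sym , distinct 2 3
      ... | no t≢p0  | no t≢p2  = p 0 , p4≡p0 , distinct 0 2 ∘ sym , t≢p0 , t≢p2

      four⇒dist≤4 : DistLe α β 4
      four⇒dist≤4 with avoiding-pair x | avoiding-pair y
      ... | a , σ²a≡a , σa≢a , x≢a , x≢σa | b , σ²b≡b , _ , y≢b , y≢σb =
        adj-dist (adj-respˡ α≈f (f-adj-^ (s<s z<s) (s<s (s<s z<s))))
          (adj-dist (total-isVertex o (distinct 0 2 ∘ sym) , γ-isVertex , total-≉-γ , ≈-sym γ-commute-total)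
            (adj-commute⇒dist≤2 (γ-isVertex , proj₁ (proj₂ idOff-adj-↦) , γ-≉-↦ , γ-commute-↦) β-isVertex ↦-commute-β))
        where
          open PairMap (f ^ 2) (^-injective 2) σ²a≡a σ²b≡b σa≢a
          open Avoiding x≢a x≢σa y≢b y≢σb

  dist≤5-and-dist≤4 : Composite (3 + n) → DistLe α β 5 × (3 + n ≡ 4 → DistLe α β 4)
  dist≤5-and-dist≤4 composite with all? InOrbit?
  ... | yes full  = composite⇒dist≤5 transitive composite , four⇒dist≤4 transitive
    where
      transitive : Transitive o
      transitive z = toℕ (proj₁ (full z)) , proj₂ (full z)
  ... | no ¬full with z∉ ← proj₂ (¬∀⟶∃¬ (3 + n) _ InOrbit? ¬full) =
    dist-mono (n≤1+n 4) (nontransitive⇒dist≤4 z∉) , λ _ → nontransitive⇒dist≤4 z∉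

lemma3p4 : (n : ℕ) → 4 ≤ n → Composite n →
    (α β : PT n) →
    IsPerm α → ¬ (α ≈ idMap) →
    ¬ IsFull β → ¬ (β ≈ emptyMap) →
    DistLe α β 5 × (n ≡ 4 → DistLe α β 4)
lemma3p4 0             ()
lemma3p4 1             (s≤s ())
lemma3p4 2             (s≤s (s≤s ()))
lemma3p4 (suc (suc (suc n))) _ composite α β (α-total , α-injective , _) α≉id β-partial β≉∅
  with x , βx ← undefined-point β β-partial
  with y , y∉imβ ← missing-image β βx =
  dist≤5-and-dist≤4 composite
  where
    f : Fin (3 + n) → Fin (3 + n)
    f = proj₁ ∘ α-total
    α≈f : α ≈ total f
    α≈f = proj₂ ∘ α-total
    f-injective : Injective _≡_ _≡_ f
    f-injective {z} {z′} fz≡fz′ = α-injective z z′ (trans (α≈f z) (trans (cong just fz≡fz′) (sym (α≈f z′))))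
    β≉id : ¬ (β ≈ idMap)
    β≉id β≈id = β-partial λ z → z , β≈id z
    open Distances (β≉∅ , β≉id) βx y∉imβ α≈f f-injective α≉id
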